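{- Let $G=N(m)$ with positive conductances, and let $i\in\mathbb{Z}$ and $j'\in\mathbb{Z}'$ be boundary vertices of $G(\infty)$ that can be joined by a path with $m$ edges. Then there exists an integer $M$ such that there is no grove $\Gamma$ (of $G(\infty)$ or of a truncation of it) with both of the following properties: (1) $\Gamma$ has a component whose set of boundary vertices is exactly $\{i,j'\}$ and which contains an edge lying strictly below (respectively, strictly above) every path with $m$ edges from $i$ to $j'$; (2) for each $t=1,\dots,M$, $\Gamma$ has a component whose set of boundary vertices is exactly $\{i+t,(j+t)'\}$ (respectively, exactly $\{i-t,(j-t)'\}$).
   Context: Fix $n\ge1$, $m\ge1$. The universal cover $G(\infty)$ of $N(m)$ has vertices $M^{(k)}_i$ ($i\in\mathbb{Z}$, $0\le k\le m$) and edges $M^{(k)}_i$–$M^{(k+1)}_i$ ("low" edges) and $M^{(k)}_i$–$M^{(k+1)}_{i-1}$ ("high" edges) for $0\le k\le m-1$; conductances are periodic of period $n$ in $i$. Boundary vertices are $i:=M^{(0)}_i$ and $i':=M^{(m)}_i$; the rest are interior. It is drawn in a vertical infinite strip with column $k$ at horizontal position $k$ and lower index increasing downwards; "below"/"above" refer to this picture (regions of the strip on the side of larger/smaller lower index of a path). A truncation is the finite network consisting of all edges incident to a finite vertex set $V$, where a vertex is interior iff it is in $V$ and interior in $G(\infty)$. A grove of a network is a spanning forest (containing all vertices) each of whose connected components contains at least one boundary vertex. -}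

module Defs where

open import Data.Nat using (ℕ; suc; _≤_)
open import Data.Integer using (ℤ; _+_; _-_; _<_; +_; 1ℤ)
open import Data.Fin using (Fin; zero; suc; inject₁; fromℕ)
open import Data.Product using (Σ; _×_; _,_; proj₁; proj₂)
open import Data.Sum using (_⊎_)
open import Data.Unit using (⊤)
open import Data.List using (List; []; _∷_; _++_; length)
open import Data.List.Membership.Propositional using (_∈_)
open import Data.List.Relation.Unary.Unique.Propositional using (Unique)
open import Relation.Binary.Construct.Closure.ReflexiveTransitive using (Star)
open import Relation.Nullary using (¬_)
open import Relation.Binary.PropositionalEquality using (_≡_)

-- Vertex M^(k)_i of G(∞) is the pair (i , k), column k ∈ {0,…,m}.
Vtx : ℕ → Set
Vtx m = ℤ × Fin (suc m)

-- low i k  : edge M^(k)_i — M^(k+1)_i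
-- high i k : edge M^(k)_i — M^(k+1)_{i-1}      (0 ≤ k ≤ m-1)
data Edge (m : ℕ) : Set where
  low  : ℤ → Fin m → Edge m
  high : ℤ → Fin m → Edge m

module _ {m : ℕ} where

  src : Edge m → Vtx m
  src (low i k)  = i , inject₁ k
  src (high i k) = i , inject₁ k

  tgt : Edge m → Vtx m
  tgt (low i k)  = i , suc k
  tgt (high i k) = i - 1ℤ , suc k

  shiftE : ℤ → Edge m → Edge m
  shiftE s (low i k)  = low (i + s) k
  shiftE s (high i k) = high (i + s) k

  IsBoundary∞ : Vtx m → Set
  IsBoundary∞ (i , k) = k ≡ zero ⊎ k ≡ fromℕ m

  Incident : Edge m → Vtx m → Set
  Incident e v = src e ≡ v ⊎ tgt e ≡ v

record Network (m : ℕ) : Set₁ where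
  field
    NVtx  : Vtx m → Set
    NEdge : Edge m → Set
    NBdry : Vtx m → Set
open Network public

G∞ : (m : ℕ) → Network m
G∞ m = record { NVtx = λ _ → ⊤ ; NEdge = λ _ → ⊤ ; NBdry = IsBoundary∞ }

-- Truncation at the finite vertex set V: all edges incident to V, their
-- endpoints as vertices; a vertex is interior iff it is in V and interior
-- in G(∞), otherwise it is a boundary vertex.
Trunc : (m : ℕ) → List (Vtx m) → Network m
Trunc m V = record
  { NVtx  = TV
  ; NEdge = TE
  ; NBdry = λ v → TV v × ¬ (v ∈ V × ¬ IsBoundary∞ v) }
  where
  TE : Edge m → Set
  TE e = Σ (Vtx m) λ v → v ∈ V × Incident e v
  TV : Vtx m → Set
  TV v = Σ (Edge m) λ e → TE e × Incident e v

data NetKind (m : ℕ) : Set where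
  full  : NetKind m
  trunc : List (Vtx m) → NetKind m

net : {m : ℕ} → NetKind m → Network m
net {m} full      = G∞ m
net {m} (trunc V) = Trunc m V

module _ {m : ℕ} (Γ : Edge m → Set) where

  Adj : Vtx m → Vtx m → Set
  Adj u v = Σ (Edge m) λ e → Γ e × ((src e ≡ u × tgt e ≡ v) ⊎ (src e ≡ v × tgt e ≡ u))

  Connected : Vtx m → Vtx m → Set
  Connected = Star Adj

  Walk : List (Vtx m) → Set
  Walk []           = ⊤
  Walk (x ∷ [])     = ⊤
  Walk (x ∷ y ∷ vs) = Adj x y × Walk (y ∷ vs)

  HasCycle : Set
  HasCycle = Σ (Vtx m) λ v → Σ (List (Vtx m)) λ rest →
    2 ≤ length rest × Unique (v ∷ rest) × Walk (v ∷ rest ++ v ∷ [])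

Grove : {m : ℕ} → Network m → (Edge m → Set) → Set
Grove {m} N Γ =
  (∀ e → Γ e → NEdge N e) × ¬ HasCycle Γ ×
  (∀ v → NVtx N v → Σ (Vtx m) λ b → NBdry N b × Connected Γ v b)

BdryExactly : {m : ℕ} → Network m → (Edge m → Set) → Vtx m → Vtx m → Set
BdryExactly {m} N Γ u w =
  NVtx N u × NBdry N u × NBdry N w × Connected Γ u w ×
  (∀ b → NBdry N b → Connected Γ u b → b ≡ u ⊎ b ≡ w)

-- boundary vertices i := M^(0)_i and j' := M^(m)_j
bdry : {m : ℕ} → ℤ → Vtx m
bdry i = i , zero

bdry' : {m : ℕ} → ℤ → Vtx m
bdry' {m} j = j , fromℕ m

-- Such a path visits each column once;
-- p k is the lower index of its vertex in column k, consecutive vertices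
-- being joined by a low edge (same index) or a high edge (index − 1).
MPath : (m : ℕ) → ℤ → ℤ → (Fin (suc m) → ℤ) → Set
MPath m i j p =
  p zero ≡ i × p (fromℕ m) ≡ j ×
  (∀ (k : Fin m) → p (suc k) ≡ p (inject₁ k) ⊎ p (suc k) ≡ p (inject₁ k) - 1ℤ)

-- the edge e lies strictly below / strictly above the path p
-- (both endpoints strictly on the larger / smaller index side in their columns)
StrictlyBelow : {m : ℕ} → Edge m → (Fin (suc m) → ℤ) → Set
StrictlyBelow e p =
  p (proj₂ (src e)) < proj₁ (src e) × p (proj₂ (tgt e)) < proj₁ (tgt e)

StrictlyAbove : {m : ℕ} → Edge m → (Fin (suc m) → ℤ) → Set
StrictlyAbove e p =
  proj₁ (src e) < p (proj₂ (src e)) × proj₁ (tgt e) < p (proj₂ (tgt e))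

CompBelow : {m : ℕ} → Network m → (Edge m → Set) → ℤ → ℤ → Set
CompBelow {m} N Γ i j =
  BdryExactly N Γ (bdry i) (bdry' j) ×
  Σ (Edge m) λ e → Γ e × Connected Γ (bdry i) (src e) ×
    (∀ p → MPath m i j p → StrictlyBelow e p)

CompAbove : {m : ℕ} → Network m → (Edge m → Set) → ℤ → ℤ → Set
CompAbove {m} N Γ i j =
  BdryExactly N Γ (bdry i) (bdry' j) ×
  Σ (Edge m) λ e → Γ e × Connected Γ (bdry i) (src e) ×
    (∀ p → MPath m i j p → StrictlyAbove e p)

module Submission where

open import Defs
open import Data.Nat using (ℕ; _≤_)
open import Data.Integer using (ℤ; +_) renaming (_+_ to _+ℤ_; _-_ to _-ℤ_)
open import Data.Rational using (ℚ; 0ℚ) renaming (_<_ to _<ℚ_)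
open import Data.Fin using (Fin)
open import Data.Product using (Σ; _×_; ∃)
open import Relation.Nullary using (¬_)
open import Relation.Binary.PropositionalEquality using (_≡_)

open import Function using (_∘_)
open import Data.Nat using (zero; suc; pred; _+_; _∸_; _<_; z≤n; s≤s)
import Data.Nat.Properties as ℕP
open import Data.Integer using (1ℤ; -_; _⊓_; _⊔_; +≤+)
  renaming (_≤_ to _≤ℤ_; _<_ to _<ℤ_; _≤?_ to _≤ℤ?_)
import Data.Integer.Properties as ℤP
open import Data.Integer.Tactic.RingSolver using (solve-∀)
open import Data.Fin using (zero; suc; inject₁; fromℕ; toℕ)
import Data.Fin.Properties as FinP
open import Data.Fin.Relation.Unary.Top using (view; ‵fromℕ; ‵inj₁)
open import Data.Product using (_,_; proj₁; proj₂)
open import Data.Sum using (_⊎_; inj₁; inj₂)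
open import Data.Empty using (⊥; ⊥-elim)
open import Data.Bool using (Bool; true; false; _∧_; _xor_)
open import Data.Bool.Properties
  using (xor-assoc; xor-comm; xor-same; xor-identityʳ; xor-∧-commutativeRing)
open import Algebra.Bundles using (CommutativeRing)
open import Algebra.Properties.CommutativeSemigroup
  (CommutativeRing.+-commutativeSemigroup xor-∧-commutativeRing) using (interchange)
open import Relation.Nullary using (yes; no)
open import Relation.Nullary.Decidable using (⌊_⌋)
open import Relation.Binary.PropositionalEquality
  using (_≢_; refl; sym; trans; cong; cong₂; subst; subst₂; module ≡-Reasoning)
open import Relation.Binary.Definitions using (Sym)
open import Relation.Binary.Construct.Closure.ReflexiveTransitive using (ε; _◅_; _◅◅_; reverse)

-- Let C_t be the component of Γ with boundary vertices exactly
-- {i+t, (j+t)'}, 0 ≤ t ≤ M.  A walk W in C_{t+1} from i+t+1 to (j+t+1)' crosses the strip,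
-- and C_t, being disjoint from W, lies on the side of W that contains i+t.  Sides are read
-- off by a discrete Jordan argument: the parity of the number of W-steps meeting a vertical
-- ray is constant along paths avoiding W.  Hence a vertex of C_t strictly below row i+t in
-- column c+1 forces a vertex of C_{t+1} strictly below row i+t+1 in column c, and a vertex
-- of C_t beyond the anti-diagonal through (j+t)' forces one of C_{t+1} a column further
-- right.  Within M stages such a sweep reaches column 0 or m, giving a component with a
-- third boundary vertex.  Comparison with the lowest m-edge path shows that an edge of C₀
-- strictly below all m-edge paths starts one of the sweeps; "above" is the mirror image.

xor-telescope : ∀ a b c → (a xor b) xor (b xor c) ≡ a xor c
xor-telescope a b c = begin
  (a xor b) xor (b xor c)  ≡⟨ xor-assoc a b (b xor c) ⟩
  a xor (b xor (b xor c))  ≡⟨ cong (a xor_) (sym (xor-assoc b b c)) ⟩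
  a xor ((b xor b) xor c)  ≡⟨ cong (λ z → a xor (z xor c)) (xor-same b) ⟩
  a xor c                  ∎
  where open ≡-Reasoning

xor-solve : ∀ p q r → p xor q ≡ r → q ≡ p xor r
xor-solve p q r pq≡r = begin
  q                  ≡⟨⟩
  false xor q        ≡⟨ cong (_xor q) (sym (xor-same p)) ⟩
  (p xor p) xor q    ≡⟨ xor-assoc p p q ⟩
  p xor (p xor q)    ≡⟨ cong (p xor_) pq≡r ⟩
  p xor r            ∎
  where open ≡-Reasoning

-1+1 : ∀ x → (x -ℤ 1ℤ) +ℤ 1ℤ ≡ x
-1+1 = solve-∀

+-swap : ∀ a b c → (a +ℤ b) +ℤ c ≡ (a +ℤ c) +ℤ b
+-swap = solve-∀

-+-cancel : ∀ a x → (a -ℤ x) +ℤ x ≡ a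
-+-cancel = solve-∀

+--cancel : ∀ a x → (a +ℤ x) -ℤ x ≡ a
+--cancel = solve-∀

-- with x = + t these read  i + (t+1) = (i + t) + 1  and  i - (t+1) = (i - t) - 1,
-- because + suc t is definitionally 1ℤ +ℤ + t
up-step : ∀ i x → i +ℤ (1ℤ +ℤ x) ≡ (i +ℤ x) +ℤ 1ℤ
up-step = solve-∀

down-step : ∀ i x → i -ℤ (1ℤ +ℤ x) ≡ (i -ℤ x) -ℤ 1ℤ
down-step = solve-∀

<⇒+1≤ : ∀ {x y} → x <ℤ y → x +ℤ 1ℤ ≤ℤ y
<⇒+1≤ {x} {y} x<y = subst (_≤ℤ y) (ℤP.+-comm 1ℤ x) (ℤP.i<j⇒suc[i]≤j x<y)

+1≤⇒< : ∀ {x y} → x +ℤ 1ℤ ≤ℤ y → x <ℤ y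
+1≤⇒< {x} {y} x+1≤y = ℤP.suc[i]≤j⇒i<j (subst (_≤ℤ y) (ℤP.+-comm x 1ℤ) x+1≤y)

<⇒≤-1 : ∀ {x y} → x <ℤ y → x ≤ℤ y -ℤ 1ℤ
<⇒≤-1 {x} {y} x<y = subst (x ≤ℤ_) (ℤP.+-comm (- 1ℤ) y) (ℤP.i<j⇒i≤pred[j] x<y)

≤-1⇒< : ∀ {x y} → x ≤ℤ y -ℤ 1ℤ → x <ℤ y
≤-1⇒< {x} {y} x≤y-1 = ℤP.i≤pred[j]⇒i<j (subst (x ≤ℤ_) (ℤP.+-comm y (- 1ℤ)) x≤y-1)

<+1 : ∀ x → x <ℤ x +ℤ 1ℤ
<+1 x = +1≤⇒< ℤP.≤-refl

-1< : ∀ x → x -ℤ 1ℤ <ℤ x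
-1< x = ≤-1⇒< ℤP.≤-refl

-1≤ : ∀ x → x -ℤ 1ℤ ≤ℤ x
-1≤ x = ℤP.i-j≤i x 1ℤ

-1-cancel-≤ : ∀ {x y} → x -ℤ 1ℤ ≤ℤ y -ℤ 1ℤ → x ≤ℤ y
-1-cancel-≤ {x} {y} le = subst₂ _≤ℤ_ (-1+1 x) (-1+1 y) (ℤP.+-monoˡ-≤ 1ℤ le)

_≤ᵇ_ : ℤ → ℤ → Bool
x ≤ᵇ y = ⌊ x ≤ℤ? y ⌋

≤ᵇ-complete : ∀ {x y} → x ≤ℤ y → x ≤ᵇ y ≡ true
≤ᵇ-complete {x} {y} x≤y with x ≤ℤ? y
... | yes _ = refl
... | no x≰y = ⊥-elim (x≰y x≤y)

≤ᵇ-sound : ∀ {x y} → x ≤ᵇ y ≡ true → x ≤ℤ y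
≤ᵇ-sound {x} {y} eq with x ≤ℤ? y
... | yes x≤y = x≤y

≤ᵇ-cong : ∀ {x y x′ y′} → (x ≤ℤ y → x′ ≤ℤ y′) → (x′ ≤ℤ y′ → x ≤ℤ y) → x ≤ᵇ y ≡ x′ ≤ᵇ y′
≤ᵇ-cong {x} {y} {x′} {y′} to from with x ≤ℤ? y | x′ ≤ℤ? y′
... | yes _ | yes _ = refl
... | no _ | no _ = refl
... | yes p | no q = ⊥-elim (q (to p))
... | no p | yes q = ⊥-elim (p (from q))

sameCol : ∀ {n} → Fin n → Fin n → Bool
sameCol zero zero = true
sameCol zero (suc _) = false
sameCol (suc _) zero = false
sameCol (suc a) (suc b) = sameCol a b

sameCol-inject₁ : ∀ {n} (a b : Fin n) → sameCol (inject₁ a) (inject₁ b) ≡ sameCol a b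
sameCol-inject₁ zero zero = refl
sameCol-inject₁ zero (suc b) = refl
sameCol-inject₁ (suc a) zero = refl
sameCol-inject₁ (suc a) (suc b) = sameCol-inject₁ a b

sameCol-sound : ∀ {n} (a b : Fin n) → sameCol a b ≡ true → a ≡ b
sameCol-sound zero zero _ = refl
sameCol-sound (suc a) (suc b) eq = cong suc (sameCol-sound a b eq)

sameCol-last : ∀ {n} (k : Fin n) → sameCol (fromℕ n) (inject₁ k) ≡ false
sameCol-last zero = refl
sameCol-last (suc k) = sameCol-last k

column₀≢last : ∀ {m} → zero ≢ fromℕ (suc m)
column₀≢last ()

downRay : ∀ {m} → Vtx m → Vtx m → Bool
downRay (x , c) (y , c′) = sameCol c′ c ∧ (x ≤ᵇ y)

upRay : ∀ {m} → Vtx m → Vtx m → Bool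
upRay (x , c) (y , c′) = sameCol c′ c ∧ (y ≤ᵇ x)

downRay-offColumn : ∀ {m} x c y c′ → sameCol c′ c ≡ false → downRay {m} (x , c) (y , c′) ≡ false
downRay-offColumn x c y c′ off rewrite off = refl

upRay-offColumn : ∀ {m} x c y c′ → sameCol c′ c ≡ false → upRay {m} (x , c) (y , c′) ≡ false
upRay-offColumn x c y c′ off rewrite off = refl

downRay-sound : ∀ {m} x c y c′ → downRay {m} (x , c) (y , c′) ≡ true → c′ ≡ c × x ≤ℤ y
downRay-sound x c y c′ onRay with sameCol c′ c in same
... | true = sameCol-sound c′ c same , ≤ᵇ-sound onRay

upRay-sound : ∀ {m} x c y c′ → upRay {m} (x , c) (y , c′) ≡ true → c′ ≡ c × y ≤ℤ x
upRay-sound x c y c′ onRay with sameCol c′ c in same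
... | true = sameCol-sound c′ c same , ≤ᵇ-sound onRay

-- Each
-- lemma assumes only the non-incidence that its proof needs.

downRay-low : ∀ {m} x (c : Fin m) (e : Edge m) → src e ≢ (x , inject₁ c) →
              downRay (x , inject₁ c) (src e) ≡ downRay (x , suc c) (tgt e)
downRay-low x c (low y c′) _ rewrite sameCol-inject₁ c′ c = refl
downRay-low x c (high y c′) src≢ rewrite sameCol-inject₁ c′ c with sameCol c′ c in same
... | false = refl
... | true with sameCol-sound c′ c same
... | refl = ≤ᵇ-cong (λ x≤y → <⇒≤-1 (ℤP.≤∧≢⇒< x≤y (λ x≡y → src≢ (cong₂ _,_ (sym x≡y) refl))))
                     (λ x≤y-1 → ℤP.≤-trans x≤y-1 (-1≤ y))

downRay-high : ∀ {m} x′ x (c : Fin m) (e : Edge m) → x′ ≡ x +ℤ 1ℤ → tgt e ≢ (x , suc c) →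
               downRay (x′ , inject₁ c) (src e) ≡ downRay (x , suc c) (tgt e)
downRay-high x′ x c (low y c′) refl tgt≢ rewrite sameCol-inject₁ c′ c with sameCol c′ c in same
... | false = refl
... | true with sameCol-sound c′ c same
... | refl = ≤ᵇ-cong (λ x+1≤y → ℤP.<⇒≤ (+1≤⇒< x+1≤y))
                     (λ x≤y → <⇒+1≤ (ℤP.≤∧≢⇒< x≤y (λ x≡y → tgt≢ (cong₂ _,_ (sym x≡y) refl))))
downRay-high x′ x c (high y c′) refl _ rewrite sameCol-inject₁ c′ c with sameCol c′ c
... | false = refl
... | true = ≤ᵇ-cong (<⇒≤-1 ∘ +1≤⇒<) (<⇒+1≤ ∘ ≤-1⇒<)

upRay-low : ∀ {m} x (c : Fin m) (e : Edge m) → tgt e ≢ (x , suc c) →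
            upRay (x , inject₁ c) (src e) ≡ upRay (x , suc c) (tgt e)
upRay-low x c (low y c′) _ rewrite sameCol-inject₁ c′ c = refl
upRay-low x c (high y c′) tgt≢ rewrite sameCol-inject₁ c′ c with sameCol c′ c in same
... | false = refl
... | true with sameCol-sound c′ c same
... | refl = ≤ᵇ-cong (λ y≤x → ℤP.≤-trans (-1≤ y) y≤x)
                     (λ y-1≤x → subst (_≤ℤ x) (-1+1 y)
                        (<⇒+1≤ (ℤP.≤∧≢⇒< y-1≤x (λ eq → tgt≢ (cong₂ _,_ eq refl)))))

upRay-high : ∀ {m} x (c : Fin m) (e : Edge m) → src e ≢ (x , inject₁ c) →
             upRay (x , inject₁ c) (src e) ≡ upRay (x -ℤ 1ℤ , suc c) (tgt e)
upRay-high x c (low y c′) src≢ rewrite sameCol-inject₁ c′ c with sameCol c′ c in same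
... | false = refl
... | true with sameCol-sound c′ c same
... | refl = ≤ᵇ-cong (λ y≤x → <⇒≤-1 (ℤP.≤∧≢⇒< y≤x (λ y≡x → src≢ (cong₂ _,_ y≡x refl))))
                     (λ y≤x-1 → ℤP.≤-trans y≤x-1 (-1≤ x))
upRay-high x c (high y c′) _ rewrite sameCol-inject₁ c′ c with sameCol c′ c
... | false = refl
... | true = ≤ᵇ-cong (ℤP.+-monoˡ-≤ (- 1ℤ)) -1-cancel-≤

downRay-transfer : ∀ {m} (f e : Edge m) → ¬ Incident e (src f) → ¬ Incident e (tgt f) →
                   downRay (src f) (src e) ≡ downRay (tgt f) (tgt e)
downRay-transfer (low y k) e avoidSrc _ = downRay-low y k e (avoidSrc ∘ inj₁)
downRay-transfer (high y k) e _ avoidTgt =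
  downRay-high y (y -ℤ 1ℤ) k e (sym (-1+1 y)) (avoidTgt ∘ inj₂)

upRay-transfer : ∀ {m} (f e : Edge m) → ¬ Incident e (src f) → ¬ Incident e (tgt f) →
                 upRay (src f) (src e) ≡ upRay (tgt f) (tgt e)
upRay-transfer (low y k) e _ avoidTgt = upRay-low y k e (avoidTgt ∘ inj₂)
upRay-transfer (high y k) e avoidSrc _ = upRay-high y k e (avoidSrc ∘ inj₁)

module WalkParity {m : ℕ} (Γ : Edge m → Set) where

  adj-sym : Sym (Adj Γ) (Adj Γ)
  adj-sym (e , γ , inj₁ ends) = e , γ , inj₂ ends
  adj-sym (e , γ , inj₂ ends) = e , γ , inj₁ ends

  parity : (Edge m → Bool) → ∀ {u v} → Connected Γ u v → Bool
  parity P ε = false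
  parity P ((e , _) ◅ w) = P e xor parity P w

  OnWalk : ∀ {u v} → Connected Γ u v → Edge m → Set
  OnWalk ε f = ⊥
  OnWalk ((e , _) ◅ w) f = e ≡ f ⊎ OnWalk w f

  Touches : ∀ {u v} → Connected Γ u v → Vtx m → Set
  Touches w z = Σ (Edge m) λ f → OnWalk w f × Incident f z

  parity-cong : ∀ P Q {u v} (w : Connected Γ u v) → (∀ f → OnWalk w f → P f ≡ Q f) →
                parity P w ≡ parity Q w
  parity-cong P Q ε _ = refl
  parity-cong P Q ((e , _) ◅ w) agree =
    cong₂ _xor_ (agree e (inj₁ refl)) (parity-cong P Q w (λ f → agree f ∘ inj₂))

  parity-false : ∀ P {u v} (w : Connected Γ u v) → (∀ f → P f ≡ false) → parity P w ≡ false
  parity-false P ε _ = refl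
  parity-false P ((e , _) ◅ w) never rewrite never e = parity-false P w never

  parity-odd : ∀ P {u v} (w : Connected Γ u v) → parity P w ≡ true →
               Σ (Edge m) λ f → OnWalk w f × P f ≡ true
  parity-odd P ε ()
  parity-odd P ((e , _) ◅ w) odd with P e in Pe
  ... | true = e , inj₁ refl , Pe
  ... | false with parity-odd P w odd
  ... | f , onW , Pf = f , inj₂ onW , Pf

  parity-telescope : ∀ (h : Vtx m → Bool) {u v} (w : Connected Γ u v) →
    parity (h ∘ src) w xor parity (h ∘ tgt) w ≡ h u xor h v
  parity-telescope h {u} ε = sym (xor-same (h u))
  parity-telescope h {u} {v} (_◅_ {j = u′} (e , _ , ends) w) = begin
    (h (src e) xor parity (h ∘ src) w) xor (h (tgt e) xor parity (h ∘ tgt) w)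
      ≡⟨ interchange (h (src e)) _ (h (tgt e)) _ ⟩
    (h (src e) xor h (tgt e)) xor (parity (h ∘ src) w xor parity (h ∘ tgt) w)
      ≡⟨ cong₂ _xor_ (oriented ends) (parity-telescope h w) ⟩
    (h u xor h u′) xor (h u′ xor h v)
      ≡⟨ xor-telescope (h u) (h u′) (h v) ⟩
    h u xor h v ∎
    where
    open ≡-Reasoning
    oriented : (src e ≡ u × tgt e ≡ u′) ⊎ (src e ≡ u′ × tgt e ≡ u) →
               h (src e) xor h (tgt e) ≡ h u xor h u′
    oriented (inj₁ (refl , refl)) = refl
    oriented (inj₂ (refl , refl)) = xor-comm (h (src e)) (h (tgt e))

  onWalk-inΓ : ∀ {u v} (w : Connected Γ u v) f → OnWalk w f → Γ f
  onWalk-inΓ ((e , γ , _) ◅ w) .e (inj₁ refl) = γ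
  onWalk-inΓ (_ ◅ w) f (inj₂ onW) = onWalk-inΓ w f onW

  onWalk-connected : ∀ {u v} (w : Connected Γ u v) f → OnWalk w f →
                     Connected Γ u (src f) × Connected Γ u (tgt f)
  onWalk-connected (step@(_ , _ , inj₁ (refl , refl)) ◅ w) _ (inj₁ refl) = ε , step ◅ ε
  onWalk-connected (step@(_ , _ , inj₂ (refl , refl)) ◅ w) _ (inj₁ refl) = step ◅ ε , ε
  onWalk-connected (step ◅ w) f (inj₂ onW) =
    let (toSrc , toTgt) = onWalk-connected w f onW in step ◅ toSrc , step ◅ toTgt

  touches-connected : ∀ {u v} (w : Connected Γ u v) z → Touches w z → Connected Γ u z
  touches-connected w z (f , onW , inj₁ refl) = proj₁ (onWalk-connected w f onW)
  touches-connected w z (f , onW , inj₂ refl) = proj₂ (onWalk-connected w f onW)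

-- The winding parity of a vertex v with respect to a walk W from a to b' (a crossing of the
-- strip), measured along a family of vertical rays: the parity of the number of W-steps
-- starting on the ray from v, corrected by whether b' itself lies on that ray.  It takes
-- the value [a on the ray from v] in column 0, and it is constant along paths in Γ that
-- avoid W.

module Winding {m : ℕ} (Γ : Edge (suc m) → Set) (ray : Vtx (suc m) → Vtx (suc m) → Bool)
  (ray-offColumn : ∀ x c y c′ → sameCol c′ c ≡ false → ray (x , c) (y , c′) ≡ false)
  (ray-transfer : ∀ f e → ¬ Incident e (src f) → ¬ Incident e (tgt f) →
                  ray (src f) (src e) ≡ ray (tgt f) (tgt e))
  {a b : ℤ} (W : Connected Γ (bdry a) (bdry' b)) where

  open WalkParity Γ

  startsOn endsOn winding : Vtx (suc m) → Bool
  startsOn v = parity (λ e → ray v (src e)) W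
  endsOn v = parity (λ e → ray v (tgt e)) W
  winding v = startsOn v xor ray v (bdry' b)

  private
    telescope : ∀ v → startsOn v xor endsOn v ≡ ray v (bdry a) xor ray v (bdry' b)
    telescope v = parity-telescope (ray v) W

  -- away from the last column the end b' is off the ray
  winding-startsOn : ∀ x (k : Fin (suc m)) → winding (x , inject₁ k) ≡ startsOn (x , inject₁ k)
  winding-startsOn x k rewrite ray-offColumn x (inject₁ k) b (fromℕ (suc m)) (sameCol-last k) =
    xor-identityʳ _

  -- away from column 0 the start a is off the ray, so the two counts can be traded
  winding-endsOn : ∀ x (k : Fin (suc m)) → winding (x , suc k) ≡ endsOn (x , suc k)
  winding-endsOn x k = sym (xor-solve (startsOn v) (endsOn v) (ray v (bdry' b))
    (trans (telescope v) (cong (_xor ray v (bdry' b)) (ray-offColumn x (suc k) a zero refl))))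
    where v = (x , suc k)

  -- no step of W ends in column 0
  winding-column₀ : ∀ x → winding (x , zero) ≡ ray (x , zero) (bdry a)
  winding-column₀ x = begin
    startsOn v xor ray v (bdry' b)              ≡⟨ cong (startsOn v xor_) bOff ⟩
    startsOn v xor false                        ≡⟨ cong (startsOn v xor_) (sym endsOff) ⟩
    startsOn v xor endsOn v                     ≡⟨ telescope v ⟩
    ray v (bdry a) xor ray v (bdry' b)          ≡⟨ cong (ray v (bdry a) xor_) bOff ⟩
    ray v (bdry a) xor false                    ≡⟨ xor-identityʳ _ ⟩
    ray v (bdry a)                              ∎
    where
    open ≡-Reasoning
    v = (x , zero)
    bOff : ray v (bdry' b) ≡ false
    bOff = ray-offColumn x zero b (fromℕ (suc m)) refl
    endsOff : endsOn v ≡ false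
    endsOff = parity-false _ W λ { (low y k) → ray-offColumn x zero y (suc k) refl
                                 ; (high y k) → ray-offColumn x zero (y -ℤ 1ℤ) (suc k) refl }

  winding-edge : ∀ f → ¬ Touches W (src f) → ¬ Touches W (tgt f) → winding (src f) ≡ winding (tgt f)
  winding-edge f avoidSrc avoidTgt = begin
    winding (src f)   ≡⟨ atSrc f ⟩
    startsOn (src f)  ≡⟨ parity-cong _ _ W (λ e onW → ray-transfer f e
                           (λ inc → avoidSrc (e , onW , inc)) (λ inc → avoidTgt (e , onW , inc))) ⟩
    endsOn (tgt f)    ≡⟨ sym (atTgt f) ⟩
    winding (tgt f)   ∎
    where
    open ≡-Reasoning
    atSrc : ∀ f → winding (src f) ≡ startsOn (src f)
    atSrc (low y k) = winding-startsOn y k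
    atSrc (high y k) = winding-startsOn y k
    atTgt : ∀ f → winding (tgt f) ≡ endsOn (tgt f)
    atTgt (low y k) = winding-endsOn y k
    atTgt (high y k) = winding-endsOn (y -ℤ 1ℤ) k

  winding-along : ∀ {u v} (P : Connected Γ u v) → (∀ z → Connected Γ u z → ¬ Touches W z) →
                  winding u ≡ winding v
  winding-along ε _ = refl
  winding-along (step@(f , _ , inj₁ (refl , refl)) ◅ P) avoid =
    trans (winding-edge f (avoid _ ε) (avoid _ (step ◅ ε)))
          (winding-along P (λ z → avoid z ∘ (step ◅_)))
  winding-along (step@(f , _ , inj₂ (refl , refl)) ◅ P) avoid =
    trans (sym (winding-edge f (avoid _ (step ◅ ε)) (avoid _ ε)))
          (winding-along P (λ z → avoid z ∘ (step ◅_)))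

descent : ∀ {A : Set} (n : ℕ) (d : A → ℕ) (Q : ℕ → A → Set) →
  (∀ t v → t ≤ n → Q t v → d v ≡ 0 → ⊥) →
  (∀ t v k → suc t ≤ n → Q t v → d v ≡ suc k → Σ A λ w → Q (suc t) w × d w ≡ k) →
  ∀ t v → Q t v → t + d v ≤ n → ⊥
descent n d Q atZero push t v q bound = go (d v) t v q refl bound
  where
  go : ∀ k t v → Q t v → d v ≡ k → t + k ≤ n → ⊥
  go zero t v q dv≡0 bound = atZero t v (subst (_≤ n) (ℕP.+-identityʳ t) bound) q dv≡0
  go (suc k) t v q dv≡ bound =
    let (w , q′ , dw≡) = push t v k (ℕP.≤-trans (s≤s (ℕP.m≤m+n t k)) bound′) q dv≡
    in go k (suc t) w q′ dw≡ bound′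
    where
    bound′ : suc (t + k) ≤ n
    bound′ = subst (_≤ n) (ℕP.+-suc t k) bound

sweepLeft : ∀ {m} (n : ℕ) (Q : ℕ → Vtx m → Set) →
  (∀ t x → t ≤ n → Q t (x , zero) → ⊥) →
  (∀ t x c → suc t ≤ n → Q t (x , suc c) → Σ ℤ λ y → Q (suc t) (y , inject₁ c)) →
  ∀ t v → Q t v → t + toℕ (proj₂ v) ≤ n → ⊥
sweepLeft {m} n Q atColumn₀ push = descent n (toℕ ∘ proj₂) Q atZero push′
  where
  atZero : ∀ t v → t ≤ n → Q t v → toℕ (proj₂ v) ≡ 0 → ⊥
  atZero t (x , zero) t≤n q _ = atColumn₀ t x t≤n q
  push′ : ∀ t v k → suc t ≤ n → Q t v → toℕ (proj₂ v) ≡ suc k →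
          Σ (Vtx m) λ w → Q (suc t) w × toℕ (proj₂ w) ≡ k
  push′ t (x , suc c) k le q c+1≡ =
    let (y , q′) = push t x c le q
    in (y , inject₁ c) , q′ , trans (FinP.toℕ-inject₁ c) (ℕP.suc-injective c+1≡)

sweepRight : ∀ {m} (n : ℕ) (Q : ℕ → Vtx m → Set) →
  (∀ t x → t ≤ n → Q t (x , fromℕ m) → ⊥) →
  (∀ t x k → suc t ≤ n → Q t (x , inject₁ k) → Σ ℤ λ y → Q (suc t) (y , suc k)) →
  ∀ t v → Q t v → t + (m ∸ toℕ (proj₂ v)) ≤ n → ⊥
sweepRight {m} n Q atLast push = descent n (λ v → m ∸ toℕ (proj₂ v)) Q atZero push′
  where
  atZero : ∀ t v → t ≤ n → Q t v → m ∸ toℕ (proj₂ v) ≡ 0 → ⊥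
  atZero t (x , c) t≤n q gap with view c
  ... | ‵fromℕ = atLast t x t≤n q
  ... | ‵inj₁ {i = k} _ = ℕP.<⇒≱ (subst (_< m) (sym (FinP.toℕ-inject₁ k)) (FinP.toℕ<n k))
                                 (ℕP.m∸n≡0⇒m≤n gap)
  push′ : ∀ t v d → suc t ≤ n → Q t v → m ∸ toℕ (proj₂ v) ≡ suc d →
          Σ (Vtx m) λ w → Q (suc t) w × m ∸ toℕ (proj₂ w) ≡ d
  push′ t (x , c) d le q gap with view c
  ... | ‵fromℕ with () ← trans (sym gap) (trans (cong (m ∸_) (FinP.toℕ-fromℕ m)) (ℕP.n∸n≡0 m))
  ... | ‵inj₁ {i = k} _ =
    let (y , q′) = push t x k le q
    in (y , suc k) , q′ , (begin
         m ∸ suc (toℕ k)              ≡⟨ sym (ℕP.pred[m∸n]≡m∸[1+n] m (toℕ k)) ⟩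
         pred (m ∸ toℕ k)             ≡⟨ cong (λ z → pred (m ∸ z)) (sym (FinP.toℕ-inject₁ k)) ⟩
         pred (m ∸ toℕ (inject₁ k))   ≡⟨ cong pred gap ⟩
         d                            ∎)
    where open ≡-Reasoning

-- A boundary vertex of G(∞) lying on an edge of Γ ⊆ N is a boundary vertex of N: in a
-- truncation, interior vertices are interior in G(∞).
boundary-inherited : ∀ {m} (κ : NetKind m) (Γ : Edge m → Set) → (∀ e → Γ e → NEdge (net κ) e) →
  ∀ v → (Σ (Edge m) λ e → Γ e × Incident e v) → IsBoundary∞ v → NBdry (net κ) v
boundary-inherited full Γ Γ⊆N v _ isB = isB
boundary-inherited (trunc V) Γ Γ⊆N v (e , γ , inc) isB =
  (e , Γ⊆N e γ , inc) , λ interior → proj₂ interior isB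

module ComponentChain {m : ℕ} (κ : NetKind (suc m)) (Γ : Edge (suc m) → Set)
  (Γ⊆N : ∀ e → Γ e → NEdge (net κ) e)
  (start end : ℕ → ℤ) (start-moves : ∀ t → start (suc t) ≢ start t)
  (exact : ∀ t → t ≤ suc m → BdryExactly (net κ) Γ (bdry (start t)) (bdry' (end t))) where

  open WalkParity Γ public

  Reached : ℕ → Vtx (suc m) → Set
  Reached t v = Connected Γ (bdry (start t)) v × Σ (Edge (suc m)) λ e → Γ e × Incident e v

  walk : ∀ t → t ≤ suc m → Connected Γ (bdry (start t)) (bdry' (end t))
  walk t le = let (_ , _ , _ , W , _) = exact t le in W

  onlyEnds : ∀ t → t ≤ suc m → ∀ v → NBdry (net κ) v → Connected Γ (bdry (start t)) v →
             v ≡ bdry (start t) ⊎ v ≡ bdry' (end t)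
  onlyEnds t le = let (_ , _ , _ , _ , only) = exact t le in only

  distinct : ∀ t → suc t ≤ suc m → ∀ z → Connected Γ (bdry (start t)) z →
             Connected Γ (bdry (start (suc t))) z → ⊥
  distinct t le z toZ toZ′ with onlyEnds t (ℕP.≤-trans (ℕP.n≤1+n t) le) _ nextIsBoundary
                                         (toZ ◅◅ reverse adj-sym toZ′)
    where
    nextIsBoundary : NBdry (net κ) (bdry (start (suc t)))
    nextIsBoundary = let (_ , isB , _) = exact (suc t) le in isB
  ... | inj₁ same = start-moves t (cong proj₁ same)
  ... | inj₂ atEnd = column₀≢last (cong proj₂ atEnd)

  avoidsNext : ∀ t (le : suc t ≤ suc m) z → Connected Γ (bdry (start t)) z →
               ¬ Touches (walk (suc t) le) z
  avoidsNext t le z toZ touch = distinct t le z toZ (touches-connected (walk (suc t) le) z touch)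

  strayStart : ∀ t → t ≤ suc m → ∀ x → Reached t (x , zero) → x ≢ start t → ⊥
  strayStart t le x (toV , onEdge) x≢
    with onlyEnds t le _ (boundary-inherited κ Γ Γ⊆N _ onEdge (inj₁ refl)) toV
  ... | inj₁ same = x≢ (cong proj₁ same)
  ... | inj₂ atEnd = column₀≢last (cong proj₂ atEnd)

  strayEnd : ∀ t → t ≤ suc m → ∀ x → Reached t (x , fromℕ (suc m)) → x ≢ end t → ⊥
  strayEnd t le x (toV , onEdge) x≢
    with onlyEnds t le _ (boundary-inherited κ Γ Γ⊆N _ onEdge (inj₂ refl)) toV
  ... | inj₁ same = column₀≢last (sym (cong proj₂ same))
  ... | inj₂ atEnd = x≢ (cong proj₁ atEnd)

  hitBySources : ∀ t (le : suc t ≤ suc m) (P : Vtx (suc m) → Bool) →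
                 parity (P ∘ src) (walk (suc t) le) ≡ true →
                 Σ (Vtx (suc m)) λ w → Reached (suc t) w × P w ≡ true
  hitBySources t le P odd =
    let (f , onW , Pf) = parity-odd (P ∘ src) (walk (suc t) le) odd
    in src f , (proj₁ (onWalk-connected _ f onW) , f , onWalk-inΓ _ f onW , inj₁ refl) , Pf

  hitByTargets : ∀ t (le : suc t ≤ suc m) (P : Vtx (suc m) → Bool) →
                 parity (P ∘ tgt) (walk (suc t) le) ≡ true →
                 Σ (Vtx (suc m)) λ w → Reached (suc t) w × P w ≡ true
  hitByTargets t le P odd =
    let (f , onW , Pf) = parity-odd (P ∘ tgt) (walk (suc t) le) odd
    in tgt f , (proj₂ (onWalk-connected _ f onW) , f , onWalk-inΓ _ f onW , inj₂ refl) , Pf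

  module Sides (ray : Vtx (suc m) → Vtx (suc m) → Bool)
    (ray-offColumn : ∀ x c y c′ → sameCol c′ c ≡ false → ray (x , c) (y , c′) ≡ false)
    (ray-transfer : ∀ f e → ¬ Incident e (src f) → ¬ Incident e (tgt f) →
                    ray (src f) (src e) ≡ ray (tgt f) (tgt e))
    (nextOnRay : ∀ t → ray (bdry (start t)) (bdry (start (suc t))) ≡ true) where

    module Next (t : ℕ) (le : suc t ≤ suc m) =
      Winding Γ ray ray-offColumn ray-transfer (walk (suc t) le)

    winding-reached : ∀ t le v → Connected Γ (bdry (start t)) v → Next.winding t le v ≡ true
    winding-reached t le v toV = begin
      Next.winding t le v                  ≡⟨ sym (Next.winding-along t le toV (avoidsNext t le)) ⟩
      Next.winding t le (bdry (start t))   ≡⟨ Next.winding-column₀ t le (start t) ⟩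
      ray (bdry (start t)) (bdry (start (suc t))) ≡⟨ nextOnRay t ⟩
      true                                 ∎
      where open ≡-Reasoning

-- Index of the anti-diagonal through a vertex; high edges stay on one anti-diagonal.
diag : ∀ {m} → Vtx m → ℤ
diag (x , c) = x +ℤ + toℕ c

-- Stage t is the component of {i+t, (j+t)'}; sides are read off with
-- downward rays, and every component lies below the walk of the next one.

module Below {m : ℕ} (κ : NetKind (suc m)) (Γ : Edge (suc m) → Set)
  (Γ⊆N : ∀ e → Γ e → NEdge (net κ) e) (i j : ℤ)
  (exact : ∀ t → t ≤ suc m → BdryExactly (net κ) Γ (bdry (i +ℤ + t)) (bdry' (j +ℤ + t))) where

  private
    moves : ∀ t → i +ℤ + suc t ≢ i +ℤ + t
    moves t eq = ℤP.<⇒≢ (<+1 (i +ℤ + t)) (sym (trans (sym (up-step i (+ t))) eq))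

    nextOnRay : ∀ t → downRay {suc m} (bdry (i +ℤ + t)) (bdry (i +ℤ + suc t)) ≡ true
    nextOnRay t = ≤ᵇ-complete (subst (i +ℤ + t ≤ℤ_) (sym (up-step i (+ t))) (ℤP.<⇒≤ (<+1 _)))

    fromI : ∀ {v} → Connected Γ (bdry i) v → Connected Γ (bdry (i +ℤ + 0)) v
    fromI {v} = subst (λ z → Connected Γ (bdry z) v) (sym (ℤP.+-identityʳ i))

  open ComponentChain κ Γ Γ⊆N (λ t → i +ℤ + t) (λ t → j +ℤ + t) moves exact
  open Sides downRay downRay-offColumn downRay-transfer nextOnRay

  BelowStartRow BeyondEndDiagonal : ℕ → Vtx (suc m) → Set
  BelowStartRow t v = Reached t v × i +ℤ + t <ℤ proj₁ v
  BeyondEndDiagonal t v = Reached t v × (j +ℤ + suc m) +ℤ + t <ℤ diag v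

  crossLeft : ∀ t le x c → Connected Γ (bdry (i +ℤ + t)) (x , suc c) →
              Next.startsOn t le (x +ℤ 1ℤ , inject₁ c) ≡ true
  crossLeft t le x c toV = begin
    Next.startsOn t le (x +ℤ 1ℤ , inject₁ c)
      ≡⟨ parity-cong _ _ (walk (suc t) le) (λ e onW → downRay-high (x +ℤ 1ℤ) x c e refl
           (λ atV → avoidsNext t le _ toV (e , onW , inj₂ atV))) ⟩
    Next.endsOn t le (x , suc c)   ≡⟨ sym (Next.winding-endsOn t le x c) ⟩
    Next.winding t le (x , suc c)  ≡⟨ winding-reached t le _ toV ⟩
    true                           ∎
    where open ≡-Reasoning

  crossRight : ∀ t le x k → Connected Γ (bdry (i +ℤ + t)) (x , inject₁ k) →
               Next.endsOn t le (x , suc k) ≡ true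
  crossRight t le x k toV = begin
    Next.endsOn t le (x , suc k)
      ≡⟨ sym (parity-cong _ _ (walk (suc t) le) (λ e onW → downRay-low x k e
           (λ atV → avoidsNext t le _ toV (e , onW , inj₁ atV)))) ⟩
    Next.startsOn t le (x , inject₁ k)  ≡⟨ sym (Next.winding-startsOn t le x k) ⟩
    Next.winding t le (x , inject₁ k)   ≡⟨ winding-reached t le _ toV ⟩
    true                                ∎
    where open ≡-Reasoning

  pushLeft : ∀ t x c → suc t ≤ suc m → BelowStartRow t (x , suc c) →
             Σ ℤ λ y → BelowStartRow (suc t) (y , inject₁ c)
  pushLeft t x c le ((toV , _) , below)
    with hitBySources t le (downRay (x +ℤ 1ℤ , inject₁ c)) (crossLeft t le x c toV)
  ... | (y , c′) , reached , onRay with downRay-sound (x +ℤ 1ℤ) (inject₁ c) y c′ onRay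
  ... | refl , x+1≤y = y , reached , ℤP.<-≤-trans lowered x+1≤y
    where
    lowered : i +ℤ + suc t <ℤ x +ℤ 1ℤ
    lowered = subst (_<ℤ x +ℤ 1ℤ) (sym (up-step i (+ t))) (ℤP.+-monoˡ-< 1ℤ below)

  pushRight : ∀ t x k → suc t ≤ suc m → BeyondEndDiagonal t (x , inject₁ k) →
              Σ ℤ λ y → BeyondEndDiagonal (suc t) (y , suc k)
  pushRight t x k le ((toV , _) , beyond)
    with hitByTargets t le (downRay (x , suc k)) (crossRight t le x k toV)
  ... | (y , c′) , reached , onRay with downRay-sound x (suc k) y c′ onRay
  ... | refl , x≤y = y , reached , subst₂ _<ℤ_ (sym (up-step J (+ t))) (sym (up-step y (+ toℕ k)))
                                     (ℤP.+-monoˡ-< 1ℤ (ℤP.<-≤-trans beyond′ moved))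
    where
    J : ℤ
    J = j +ℤ + suc m
    moved : x +ℤ + toℕ k ≤ℤ y +ℤ + toℕ k
    moved = ℤP.+-monoˡ-≤ (+ toℕ k) x≤y
    beyond′ : J +ℤ + t <ℤ x +ℤ + toℕ k
    beyond′ = subst (λ n → J +ℤ + t <ℤ x +ℤ + n) (FinP.toℕ-inject₁ k) beyond

  atColumn₀ : ∀ t x → t ≤ suc m → BelowStartRow t (x , zero) → ⊥
  atColumn₀ t x le (reached , below) = strayStart t le x reached (ℤP.<⇒≢ below ∘ sym)

  atLastColumn : ∀ t x → t ≤ suc m → BeyondEndDiagonal t (x , fromℕ (suc m)) → ⊥
  atLastColumn t x le (reached , beyond) = strayEnd t le x reached λ x≡j+t →
    ℤP.<-irrefl (+-swap j (+ suc m) (+ t))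
      (subst₂ (λ z n → (j +ℤ + suc m) +ℤ + t <ℤ z +ℤ + n) x≡j+t (FinP.toℕ-fromℕ (suc m)) beyond)

  nothingBelow : ∀ v → Connected Γ (bdry i) v → (Σ (Edge (suc m)) λ e → Γ e × Incident e v) →
                 i <ℤ proj₁ v ⊎ j +ℤ + suc m <ℤ diag v → ⊥
  nothingBelow v toV onEdge (inj₁ i<x) =
    sweepLeft (suc m) BelowStartRow atColumn₀ pushLeft 0 v
      ((fromI toV , onEdge) , subst (_<ℤ proj₁ v) (sym (ℤP.+-identityʳ i)) i<x)
      (FinP.toℕ≤pred[n] (proj₂ v))
  nothingBelow v toV onEdge (inj₂ J<diag) =
    sweepRight (suc m) BeyondEndDiagonal atLastColumn pushRight 0 v
      ((fromI toV , onEdge) , subst (_<ℤ diag v) (sym (ℤP.+-identityʳ _)) J<diag)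
      (ℕP.m∸n≤m (suc m) (toℕ (proj₂ v)))

-- The "above" case, the mirror image: stage t is the component of {i-t, (j-t)'}, sides are
-- read off with upward rays.

module Above {m : ℕ} (κ : NetKind (suc m)) (Γ : Edge (suc m) → Set)
  (Γ⊆N : ∀ e → Γ e → NEdge (net κ) e) (i j : ℤ)
  (exact : ∀ t → t ≤ suc m → BdryExactly (net κ) Γ (bdry (i -ℤ + t)) (bdry' (j -ℤ + t))) where

  private
    moves : ∀ t → i -ℤ + suc t ≢ i -ℤ + t
    moves t eq = ℤP.<⇒≢ (-1< (i -ℤ + t)) (trans (sym (down-step i (+ t))) eq)

    nextOnRay : ∀ t → upRay {suc m} (bdry (i -ℤ + t)) (bdry (i -ℤ + suc t)) ≡ true
    nextOnRay t = ≤ᵇ-complete (subst (_≤ℤ i -ℤ + t) (sym (down-step i (+ t))) (-1≤ _))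

    fromI : ∀ {v} → Connected Γ (bdry i) v → Connected Γ (bdry (i -ℤ + 0)) v
    fromI {v} = subst (λ z → Connected Γ (bdry z) v) (sym (ℤP.+-identityʳ i))

  open ComponentChain κ Γ Γ⊆N (λ t → i -ℤ + t) (λ t → j -ℤ + t) moves exact
  open Sides upRay upRay-offColumn upRay-transfer nextOnRay

  AboveEndRow BeforeStartDiagonal : ℕ → Vtx (suc m) → Set
  AboveEndRow t v = Reached t v × proj₁ v <ℤ j -ℤ + t
  BeforeStartDiagonal t v = Reached t v × diag v <ℤ i -ℤ + t

  crossRight : ∀ t le x k → Connected Γ (bdry (i -ℤ + t)) (x , inject₁ k) →
               Next.endsOn t le (x -ℤ 1ℤ , suc k) ≡ true
  crossRight t le x k toV = begin
    Next.endsOn t le (x -ℤ 1ℤ , suc k)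
      ≡⟨ sym (parity-cong _ _ (walk (suc t) le) (λ e onW → upRay-high x k e
           (λ atV → avoidsNext t le _ toV (e , onW , inj₁ atV)))) ⟩
    Next.startsOn t le (x , inject₁ k)  ≡⟨ sym (Next.winding-startsOn t le x k) ⟩
    Next.winding t le (x , inject₁ k)   ≡⟨ winding-reached t le _ toV ⟩
    true                                ∎
    where open ≡-Reasoning

  crossLeft : ∀ t le x c → Connected Γ (bdry (i -ℤ + t)) (x , suc c) →
              Next.startsOn t le (x , inject₁ c) ≡ true
  crossLeft t le x c toV = begin
    Next.startsOn t le (x , inject₁ c)
      ≡⟨ parity-cong _ _ (walk (suc t) le) (λ e onW → upRay-low x c e
           (λ atV → avoidsNext t le _ toV (e , onW , inj₂ atV))) ⟩
    Next.endsOn t le (x , suc c)   ≡⟨ sym (Next.winding-endsOn t le x c) ⟩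
    Next.winding t le (x , suc c)  ≡⟨ winding-reached t le _ toV ⟩
    true                           ∎
    where open ≡-Reasoning

  pushRight : ∀ t x k → suc t ≤ suc m → AboveEndRow t (x , inject₁ k) →
              Σ ℤ λ y → AboveEndRow (suc t) (y , suc k)
  pushRight t x k le ((toV , _) , above)
    with hitByTargets t le (upRay (x -ℤ 1ℤ , suc k)) (crossRight t le x k toV)
  ... | (y , c′) , reached , onRay with upRay-sound (x -ℤ 1ℤ) (suc k) y c′ onRay
  ... | refl , y≤x-1 = y , reached , subst (y <ℤ_) (sym (down-step j (+ t)))
                                       (ℤP.≤-<-trans y≤x-1 (ℤP.+-monoˡ-< (- 1ℤ) above))

  pushLeft : ∀ t x c → suc t ≤ suc m → BeforeStartDiagonal t (x , suc c) →
             Σ ℤ λ y → BeforeStartDiagonal (suc t) (y , inject₁ c)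
  pushLeft t x c le ((toV , _) , before)
    with hitBySources t le (upRay (x , inject₁ c)) (crossLeft t le x c toV)
  ... | (y , c′) , reached , onRay with upRay-sound x (inject₁ c) y c′ onRay
  ... | refl , y≤x = y , reached , subst₂ _<ℤ_ (cong (λ n → y +ℤ + n) (sym (FinP.toℕ-inject₁ c)))
                                       (sym (down-step i (+ t)))
                                       (ℤP.≤-<-trans (ℤP.+-monoˡ-≤ (+ toℕ c) y≤x) before′)
    where
    before′ : x +ℤ + toℕ c <ℤ (i -ℤ + t) -ℤ 1ℤ
    before′ = +1≤⇒< (<⇒≤-1 (subst (_<ℤ i -ℤ + t) (up-step x (+ toℕ c)) before))

  atColumn₀ : ∀ t x → t ≤ suc m → BeforeStartDiagonal t (x , zero) → ⊥
  atColumn₀ t x le (reached , before) =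
    strayStart t le x reached (ℤP.<⇒≢ (subst (_<ℤ i -ℤ + t) (ℤP.+-identityʳ x) before))

  atLastColumn : ∀ t x → t ≤ suc m → AboveEndRow t (x , fromℕ (suc m)) → ⊥
  atLastColumn t x le (reached , above) = strayEnd t le x reached (ℤP.<⇒≢ above)

  nothingAbove : ∀ v → Connected Γ (bdry i) v → (Σ (Edge (suc m)) λ e → Γ e × Incident e v) →
                 proj₁ v <ℤ j ⊎ diag v <ℤ i → ⊥
  nothingAbove v toV onEdge (inj₁ x<j) =
    sweepRight (suc m) AboveEndRow atLastColumn pushRight 0 v
      ((fromI toV , onEdge) , subst (proj₁ v <ℤ_) (sym (ℤP.+-identityʳ j)) x<j)
      (ℕP.m∸n≤m (suc m) (toℕ (proj₂ v)))
  nothingAbove v toV onEdge (inj₂ diag<i) =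
    sweepLeft (suc m) BeforeStartDiagonal atColumn₀ pushLeft 0 v
      ((fromI toV , onEdge) , subst (diag v <ℤ_) (sym (ℤP.+-identityʳ i)) diag<i)
      (FinP.toℕ≤pred[n] (proj₂ v))

-- Every step keeps the index or lowers it by one, so the
-- index drops by between 0 and m in total; the lowest and the highest such path clamp
-- the diagonals through j' and through i.

UnitSteps : ∀ m → (Fin (suc m) → ℤ) → Set
UnitSteps m p = ∀ (k : Fin m) → p (suc k) ≡ p (inject₁ k) ⊎ p (suc k) ≡ p (inject₁ k) -ℤ 1ℤ

path-range : ∀ m (p : Fin (suc m) → ℤ) → UnitSteps m p →
             p (fromℕ m) ≤ℤ p zero × p zero ≤ℤ p (fromℕ m) +ℤ + m
path-range zero p _ = ℤP.≤-refl , ℤP.≤-reflexive (sym (ℤP.+-identityʳ _))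
path-range (suc m) p steps with path-range m (p ∘ inject₁) (steps ∘ inject₁) | steps (fromℕ m)
... | last≤first , first≤last+m | inj₁ same =
  subst (_≤ℤ p zero) (sym same) last≤first ,
  ℤP.≤-trans first≤last+m (subst (λ z → q +ℤ + m ≤ℤ z +ℤ + suc m) (sym same)
                                  (ℤP.+-monoʳ-≤ q (+≤+ (ℕP.n≤1+n m))))
  where
  q : ℤ
  q = p (inject₁ (fromℕ m))
... | last≤first , first≤last+m | inj₂ drop =
  subst (_≤ℤ p zero) (sym drop) (ℤP.≤-trans (-1≤ q) last≤first) ,
  ℤP.≤-trans first≤last+m (ℤP.≤-reflexive (trans (regroup q (+ m)) (cong (_+ℤ + suc m) (sym drop))))
  where
  q : ℤ
  q = p (inject₁ (fromℕ m))
  regroup : ∀ q x → q +ℤ x ≡ (q -ℤ 1ℤ) +ℤ (1ℤ +ℤ x)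
  regroup = solve-∀

⊓-unitDrop : ∀ a b → a ⊓ (b -ℤ 1ℤ) ≡ a ⊓ b ⊎ a ⊓ (b -ℤ 1ℤ) ≡ (a ⊓ b) -ℤ 1ℤ
⊓-unitDrop a b with a ≤ℤ? b -ℤ 1ℤ
... | yes a≤b-1 = inj₁ (trans (ℤP.i≤j⇒i⊓j≡i a≤b-1)
                            (sym (ℤP.i≤j⇒i⊓j≡i (ℤP.≤-trans a≤b-1 (-1≤ b)))))
... | no a≰b-1 = inj₂ (trans (ℤP.i≥j⇒i⊓j≡j (ℤP.<⇒≤ b-1<a)) (cong (_-ℤ 1ℤ) (sym (ℤP.i≥j⇒i⊓j≡j b≤a))))
  where
  b-1<a : b -ℤ 1ℤ <ℤ a
  b-1<a = ℤP.≰⇒> a≰b-1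
  b≤a : b ≤ℤ a
  b≤a = subst (_≤ℤ a) (-1+1 b) (<⇒+1≤ b-1<a)

⊔-unitDrop : ∀ a b → a ⊔ (b -ℤ 1ℤ) ≡ a ⊔ b ⊎ a ⊔ (b -ℤ 1ℤ) ≡ (a ⊔ b) -ℤ 1ℤ
⊔-unitDrop a b with a ≤ℤ? b -ℤ 1ℤ
... | yes a≤b-1 = inj₂ (trans (ℤP.i≤j⇒i⊔j≡j a≤b-1)
                            (cong (_-ℤ 1ℤ) (sym (ℤP.i≤j⇒i⊔j≡j (ℤP.≤-trans a≤b-1 (-1≤ b))))))
... | no a≰b-1 = inj₁ (trans (ℤP.i≥j⇒i⊔j≡i (ℤP.<⇒≤ b-1<a)) (sym (ℤP.i≥j⇒i⊔j≡i b≤a)))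
  where
  b-1<a : b -ℤ 1ℤ <ℤ a
  b-1<a = ℤP.≰⇒> a≰b-1
  b≤a : b ≤ℤ a
  b≤a = subst (_≤ℤ a) (-1+1 b) (<⇒+1≤ b-1<a)

lowestPath : ∀ m → ℤ → ℤ → Fin (suc m) → ℤ
lowestPath m i j k = i ⊓ ((j +ℤ + m) -ℤ + toℕ k)

highestPath : ∀ m → ℤ → ℤ → Fin (suc m) → ℤ
highestPath m i j k = j ⊔ (i -ℤ + toℕ k)

lowest-isPath : ∀ m i j → j ≤ℤ i → i ≤ℤ j +ℤ + m → MPath m i j (lowestPath m i j)
lowest-isPath m i j j≤i i≤j+m =
  ℤP.i≤j⇒i⊓j≡i (subst (i ≤ℤ_) (sym (ℤP.+-identityʳ _)) i≤j+m) ,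
  trans (cong (λ n → i ⊓ ((j +ℤ + m) -ℤ + n)) (FinP.toℕ-fromℕ m))
        (trans (cong (i ⊓_) (+--cancel j (+ m))) (ℤP.i≥j⇒i⊓j≡j j≤i)) ,
  λ k → subst₂ (λ a b → i ⊓ a ≡ i ⊓ b ⊎ i ⊓ a ≡ (i ⊓ b) -ℤ 1ℤ)
          (sym (down-step (j +ℤ + m) (+ toℕ k)))
          (cong (λ n → (j +ℤ + m) -ℤ + n) (sym (FinP.toℕ-inject₁ k)))
          (⊓-unitDrop i ((j +ℤ + m) -ℤ + toℕ k))

highest-isPath : ∀ m i j → j ≤ℤ i → i ≤ℤ j +ℤ + m → MPath m i j (highestPath m i j)
highest-isPath m i j j≤i i≤j+m =
  trans (ℤP.i≤j⇒i⊔j≡j (subst (j ≤ℤ_) (sym (ℤP.+-identityʳ i)) j≤i)) (ℤP.+-identityʳ i) ,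
  trans (cong (λ n → j ⊔ (i -ℤ + n)) (FinP.toℕ-fromℕ m))
        (ℤP.i≥j⇒i⊔j≡i (subst (i -ℤ + m ≤ℤ_) (+--cancel j (+ m)) (ℤP.+-monoˡ-≤ (- (+ m)) i≤j+m))) ,
  λ k → subst₂ (λ a b → j ⊔ a ≡ j ⊔ b ⊎ j ⊔ a ≡ (j ⊔ b) -ℤ 1ℤ)
          (sym (down-step i (+ toℕ k)))
          (cong (λ n → i -ℤ + n) (sym (FinP.toℕ-inject₁ k)))
          (⊔-unitDrop j (i -ℤ + toℕ k))

below-lowest : ∀ m i j (v : Vtx m) → lowestPath m i j (proj₂ v) <ℤ proj₁ v →
               i <ℤ proj₁ v ⊎ j +ℤ + m <ℤ diag v
below-lowest m i j (x , c) below with ℤP.⊓-sel i ((j +ℤ + m) -ℤ + toℕ c)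
... | inj₁ eq = inj₁ (subst (_<ℤ x) eq below)
... | inj₂ eq = inj₂ (subst (_<ℤ x +ℤ + toℕ c) (-+-cancel (j +ℤ + m) (+ toℕ c))
                        (ℤP.+-monoˡ-< (+ toℕ c) (subst (_<ℤ x) eq below)))

above-highest : ∀ m i j (v : Vtx m) → proj₁ v <ℤ highestPath m i j (proj₂ v) →
                proj₁ v <ℤ j ⊎ diag v <ℤ i
above-highest m i j (x , c) above with ℤP.⊔-sel j (i -ℤ + toℕ c)
... | inj₁ eq = inj₁ (subst (x <ℤ_) eq above)
... | inj₂ eq = inj₂ (subst (x +ℤ + toℕ c <ℤ_) (-+-cancel i (+ toℕ c))
                        (ℤP.+-monoˡ-< (+ toℕ c) (subst (x <ℤ_) eq above)))

-- Stage 0 of the chain is the component of {i, j'} itself (i -ℤ + 0 unfolds to i +ℤ + 0,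
-- so this serves both cases); allStages adds it to the stages 1 ≤ t ≤ M.
stage₀ : ∀ {m} (N : Network m) (Γ : Edge m → Set) {i j : ℤ} →
         BdryExactly N Γ (bdry i) (bdry' j) → BdryExactly N Γ (bdry (i +ℤ + 0)) (bdry' (j +ℤ + 0))
stage₀ N Γ {i} {j} = subst₂ (λ a b → BdryExactly N Γ (bdry a) (bdry' b))
                            (sym (ℤP.+-identityʳ i)) (sym (ℤP.+-identityʳ j))

allStages : ∀ {M} (P : ℕ → Set) → P 0 → (∀ t → 1 ≤ t → t ≤ M → P t) → ∀ t → t ≤ M → P t
allStages P p₀ later zero _ = p₀
allStages P p₀ later (suc t) le = later (suc t) (s≤s z≤n) le

noGroveBelow : ∀ {m} (κ : NetKind (suc m)) (Γ : Edge (suc m) → Set) (i j : ℤ) →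
  j ≤ℤ i → i ≤ℤ j +ℤ + suc m →
  ¬ (Grove (net κ) Γ × CompBelow (net κ) Γ i j ×
     (∀ t → 1 ≤ t → t ≤ suc m → BdryExactly (net κ) Γ (bdry (i +ℤ + t)) (bdry' (j +ℤ + t))))
noGroveBelow {m} κ Γ i j j≤i i≤j+m ((Γ⊆N , _) , (exact₀ , e , γ , toE , strictlyBelow) , later) =
  nothingBelow (src e) toE (e , γ , inj₁ refl) (below-lowest (suc m) i j (src e) belowLowest)
  where
  open Below κ Γ Γ⊆N i j (allStages _ (stage₀ (net κ) Γ exact₀) later)
  belowLowest : lowestPath (suc m) i j (proj₂ (src e)) <ℤ proj₁ (src e)
  belowLowest = proj₁ (strictlyBelow (lowestPath (suc m) i j)
                                     (lowest-isPath (suc m) i j j≤i i≤j+m))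

noGroveAbove : ∀ {m} (κ : NetKind (suc m)) (Γ : Edge (suc m) → Set) (i j : ℤ) →
  j ≤ℤ i → i ≤ℤ j +ℤ + suc m →
  ¬ (Grove (net κ) Γ × CompAbove (net κ) Γ i j ×
     (∀ t → 1 ≤ t → t ≤ suc m → BdryExactly (net κ) Γ (bdry (i -ℤ + t)) (bdry' (j -ℤ + t))))
noGroveAbove {m} κ Γ i j j≤i i≤j+m ((Γ⊆N , _) , (exact₀ , e , γ , toE , strictlyAbove) , later) =
  nothingAbove (src e) toE (e , γ , inj₁ refl) (above-highest (suc m) i j (src e) aboveHighest)
  where
  open Above κ Γ Γ⊆N i j (allStages _ (stage₀ (net κ) Γ exact₀) later)
  aboveHighest : proj₁ (src e) <ℤ highestPath (suc m) i j (proj₂ (src e))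
  aboveHighest = proj₁ (strictlyAbove (highestPath (suc m) i j)
                                      (highest-isPath (suc m) i j j≤i i≤j+m))

-- Lemma 5.7.  One may take M = m.  The given path only serves to locate j' relative to i.
lemma5p7 : (n m : ℕ) → 1 ≤ n → 1 ≤ m →
  (c : Edge m → ℚ) → (∀ e → 0ℚ <ℚ c e) → (∀ e → c (shiftE (+ n) e) ≡ c e) →
  (i j : ℤ) → Σ (Fin _ → ℤ) (MPath m i j) →
  (∃ λ (M : ℕ) → ∀ (κ : NetKind m) (Γ : Edge m → Set) →
     ¬ (Grove (net κ) Γ × CompBelow (net κ) Γ i j ×
        (∀ (t : ℕ) → 1 ≤ t → t ≤ M →
           BdryExactly (net κ) Γ (bdry (i +ℤ + t)) (bdry' (j +ℤ + t)))))
  ×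
  (∃ λ (M : ℕ) → ∀ (κ : NetKind m) (Γ : Edge m → Set) →
     ¬ (Grove (net κ) Γ × CompAbove (net κ) Γ i j ×
        (∀ (t : ℕ) → 1 ≤ t → t ≤ M →
           BdryExactly (net κ) Γ (bdry (i -ℤ + t)) (bdry' (j -ℤ + t)))))
lemma5p7 n zero _ () _ _ _ _ _ _
lemma5p7 n (suc m) _ _ _ _ _ i j (p , p₀≡i , pₘ≡j , steps) =
  (suc m , λ κ Γ → noGroveBelow κ Γ i j j≤i i≤j+m) ,
  (suc m , λ κ Γ → noGroveAbove κ Γ i j j≤i i≤j+m)
  where
  range : p (fromℕ (suc m)) ≤ℤ p zero × p zero ≤ℤ p (fromℕ (suc m)) +ℤ + suc m
  range = path-range (suc m) p steps
  j≤i : j ≤ℤ i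
  j≤i = subst₂ _≤ℤ_ pₘ≡j p₀≡i (proj₁ range)
  i≤j+m : i ≤ℤ j +ℤ + suc m
  i≤j+m = subst₂ (λ a b → a ≤ℤ b +ℤ + suc m) p₀≡i pₘ≡j (proj₂ range)
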